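{- Let $n\ge 11$ and $T_{n,n-6}=\frac{n(n+1)}{2}-(n-6)$. Then $\#\mathbb U^*_{T_{n,n-6}}=2$.
   Context: A partition of $N$ into distinct parts is a sequence of positive integers $\lambda_1<\dots<\lambda_t$ summing to $N$ with $t\ge 2$. Its missing parts are the elements of $\{1,\dots,\lambda_t\}\setminus\{\lambda_1,\dots,\lambda_t\}$. $\lambda$ is refinable if two distinct missing parts sum to a part of $\lambda$, unrefinable otherwise; $\mathbb U_N$ is the set of unrefinable partitions of $N$. $\mathbb U^*_N$ is the set of $\lambda\in\mathbb U_N$ whose largest part is the maximum of the largest parts over all of $\mathbb U_N$. Standing assumption: $n\ge 11$. -}

module Defs where

open import Data.Nat using (ℕ; zero; suc; _+_; _*_; _∸_; _≤_; _<_; _⊔_)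
open import Data.Nat.DivMod using (_/_)
open import Data.List using (List; []; _∷_; length; foldr)
open import Data.Nat.ListAction using (sum)
open import Data.Sum using (_⊎_)
open import Data.List.Relation.Unary.All using (All)
open import Data.List.Relation.Unary.Linked using (Linked)
open import Data.List.Membership.Propositional using (_∈_; _∉_)
open import Data.Product using (_×_; ∃; ∃-syntax)
open import Relation.Nullary using (¬_)
open import Relation.Binary.PropositionalEquality using (_≡_; _≢_)

record DistinctPartition (N : ℕ) (λs : List ℕ) : Set where
  field
    increasing : Linked _<_ λs
    positive   : All (0 <_) λs
    sums       : sum λs ≡ N
    atLeastTwo : 2 ≤ length λs

-- largest part λₜ (the maximum of the list; 0 for the empty list)
largest : List ℕ → ℕ
largest = foldr _⊔_ 0

Missing : List ℕ → ℕ → Set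
Missing λs m = (1 ≤ m) × (m ≤ largest λs) × (m ∉ λs)

Refinable : List ℕ → Set
Refinable λs = ∃[ a ] ∃[ b ] (a ≢ b × Missing λs a × Missing λs b × (a + b) ∈ λs)

Unrefinable : List ℕ → Set
Unrefinable λs = ¬ Refinable λs

InU : ℕ → List ℕ → Set
InU N λs = DistinctPartition N λs × Unrefinable λs

InUStar : ℕ → List ℕ → Set
InUStar N λs = InU N λs × (∀ μ → InU N μ → largest μ ≤ largest λs)

HasExactlyTwo : (List ℕ → Set) → Set
HasExactlyTwo P = ∃[ x ] ∃[ y ] (x ≢ y × P x × P y × (∀ z → P z → z ≡ x ⊎ z ≡ y))

T : ℕ → ℕ → ℕ
T n k = (n * suc n) / 2 ∸ k

{-# OPTIONS --safe #-}
-- Let M be the largest part of an unrefinable partition λ of N = T_{n,n−6}. For a < M − a the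
-- values a and M − a cannot both be missing, since they would refine M; so each such pair
-- contributes to N its lower member a plus an excess 0, M − 2a or M − a. Summing over the pairs,
-- N ≥ (1 + ⋯ + ⌊(M − 1)/2⌋) + M, which forces M ≤ 2n − 5 unless M = 2n − 4; in that case the
-- excesses, each even or larger than 7, would have to sum to 7 (or less, if n − 2 is a part).
-- For M = 2n − 5 the excesses sum to 8. A pair with a ≤ n − 7 cannot carry excess (it would be at
-- least 9), so 8 is made from the excesses 7, 5, 3, 1 available at a = n − 6, …, n − 3, either as
-- 7 + 1 or as 5 + 3; each choice determines λ, and both are realised.
module Submission where

open import Defs
open import Data.Nat using (ℕ; zero; suc; _+_; _*_; _∸_; _≤_; _<_; z≤n; s≤s; s≤s⁻¹; _≟_; _≤?_; _<?_; _/_)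
open import Data.Nat.Properties
open import Algebra.Properties.CommutativeSemigroup +-commutativeSemigroup using (interchange; x∙yz≈y∙xz)
open import Data.Nat.Divisibility using (_∣_; _∣?_; divides; _∣0; ∣m∣n⇒∣m+n)
open import Data.Nat.DivMod using (m*n/n≡m)
open import Data.Nat.Tactic.RingSolver using (solve-∀)
open import Data.List using (List; []; _∷_; _++_; length; applyUpTo)
open import Data.List.Properties using (applyUpTo-∷ʳ; length-applyUpTo; length-++)
open import Data.List.Membership.Propositional.Properties using (∈-applyUpTo⁺; ∈-applyUpTo⁻; ∈-++⁺ˡ; ∈-++⁺ʳ; ∈-++⁻)
open import Data.List.Relation.Unary.All.Properties using () renaming (++⁺ to All-++⁺)
import Data.List.Relation.Unary.AllPairs.Properties as AllPairs
open import Data.Nat.ListAction using (sum)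
open import Data.Nat.ListAction.Properties using (sum-++)
open import Data.List.Relation.Unary.All as All using (All; []; _∷_)
open import Data.List.Relation.Unary.Any using (here; there)
open import Data.List.Relation.Unary.AllPairs using (_∷_)
open import Data.List.Relation.Unary.Linked as Linked using (Linked; [-]; _∷_)
open import Data.List.Relation.Unary.Linked.Properties using (Linked⇒AllPairs; AllPairs⇒Linked; applyUpTo⁺₂)
open import Data.List.Membership.Propositional using (_∈_; _∉_)
open import Data.Product using (Σ; _×_; _,_; proj₁; proj₂; ∃)
open import Data.Sum using (_⊎_; inj₁; inj₂; [_,_]′)
open import Data.Empty using (⊥; ⊥-elim)
open import Function using (id; _∘_)
open import Relation.Nullary using (¬_; yes; no)
open import Relation.Nullary.Decidable using (True; toWitness; from-no)
open import Relation.Binary.Definitions using (tri<; tri≈; tri>)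
open import Relation.Binary.PropositionalEquality

∑ : ℕ → (ℕ → ℕ) → ℕ
∑ zero    f = 0
∑ (suc K) f = ∑ K f + f (suc K)

-- ∑[ i ≤ K ] f i is f 1 + ⋯ + f K: the index starts at 1.
infix 6.5 ∑
syntax ∑ K (λ i → e) = ∑[ i ≤ K ] e

tri : ℕ → ℕ
tri n = ∑[ i ≤ n ] i

∑-cong : ∀ {f g} K → (∀ {i} → 1 ≤ i → i ≤ K → f i ≡ g i) → ∑ K f ≡ ∑ K g
∑-cong zero    f≡g = refl
∑-cong (suc K) f≡g = cong₂ _+_ (∑-cong K λ p q → f≡g p (m≤n⇒m≤1+n q)) (f≡g (s≤s z≤n) ≤-refl)

∑-zero : ∀ {f} K → (∀ {i} → 1 ≤ i → i ≤ K → f i ≡ 0) → ∑ K f ≡ 0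
∑-zero zero    f≡0 = refl
∑-zero (suc K) f≡0 = cong₂ _+_ (∑-zero K λ p q → f≡0 p (m≤n⇒m≤1+n q)) (f≡0 (s≤s z≤n) ≤-refl)

∑-divisible : ∀ {d f} K → (∀ {i} → 1 ≤ i → i ≤ K → d ∣ f i) → d ∣ ∑ K f
∑-divisible {d} zero    d∣f = d ∣0
∑-divisible     (suc K) d∣f =
  ∣m∣n⇒∣m+n (∑-divisible K λ p q → d∣f p (m≤n⇒m≤1+n q)) (d∣f (s≤s z≤n) ≤-refl)

∑-distrib-+ : ∀ f g K → ∑[ i ≤ K ] (f i + g i) ≡ ∑ K f + ∑ K g
∑-distrib-+ f g zero    = refl
∑-distrib-+ f g (suc K) =
  trans (cong (_+ (f (suc K) + g (suc K))) (∑-distrib-+ f g K)) (interchange (∑ K f) (∑ K g) _ _)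

∑-suc : ∀ f K → ∑ (suc K) f ≡ f 1 + ∑[ i ≤ K ] f (suc i)
∑-suc f zero    = +-comm 0 (f 1)
∑-suc f (suc K) = trans (cong (_+ f (2 + K)) (∑-suc f K)) (+-assoc (f 1) _ _)

∑-split : ∀ f m n → ∑ (m + n) f ≡ ∑ m f + ∑[ i ≤ n ] f (i + m)
∑-split f m zero    = trans (cong (λ K → ∑ K f) (+-identityʳ m)) (sym (+-identityʳ (∑ m f)))
∑-split f m (suc n) = begin
  ∑ (m + suc n) f                                        ≡⟨ cong (λ K → ∑ K f) (+-suc m n) ⟩
  ∑ (m + n) f + f (suc (m + n))                          ≡⟨ cong₂ _+_ (∑-split f m n) (cong (λ x → f (suc x)) (+-comm m n)) ⟩
  (∑ m f + ∑[ i ≤ n ] f (i + m)) + f (suc n + m)         ≡⟨ +-assoc (∑ m f) _ _ ⟩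
  ∑ m f + ∑[ i ≤ suc n ] f (i + m)                       ∎
  where open ≡-Reasoning

∑-reflect : ∀ {f g} K → (∀ i j → i + j ≡ suc K → f i ≡ g j) → ∑ K f ≡ ∑ K g
∑-reflect         zero    _   = refl
∑-reflect {f} {g} (suc K) f≡g = begin
  ∑ K f + f (suc K)                ≡⟨ cong₂ _+_ (∑-reflect K λ i j i+j≡ → f≡g i (suc j) (trans (+-suc i j) (cong suc i+j≡)))
                                                (f≡g (suc K) 1 (+-comm (suc K) 1)) ⟩
  ∑[ j ≤ K ] g (suc j) + g 1       ≡⟨ +-comm _ (g 1) ⟩
  g 1 + ∑[ j ≤ K ] g (suc j)       ≡⟨ sym (∑-suc g K) ⟩
  ∑ (suc K) g                      ∎
  where open ≡-Reasoning

∑-pairing : ∀ f m c → ∑ (m + (c + m)) f ≡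
            ∑[ i ≤ c ] f (i + m) + ∑[ a ≤ m ] (f a + f (suc (m + (c + m)) ∸ a))
∑-pairing f m c = begin
  ∑ (m + (c + m)) f                                                     ≡⟨ ∑-split f m (c + m) ⟩
  ∑ m f + ∑[ i ≤ c + m ] f (i + m)                                      ≡⟨ cong (∑ m f +_) (∑-split (λ i → f (i + m)) c m) ⟩
  ∑ m f + (∑[ i ≤ c ] f (i + m) + ∑[ i ≤ m ] f ((i + c) + m))           ≡⟨ cong (λ s → ∑ m f + (∑[ i ≤ c ] f (i + m) + s)) (∑-reflect m mirror) ⟩
  ∑ m f + (∑[ i ≤ c ] f (i + m) + ∑[ a ≤ m ] f (M ∸ a))                 ≡⟨ x∙yz≈y∙xz (∑ m f) (∑[ i ≤ c ] f (i + m)) _ ⟩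
  ∑[ i ≤ c ] f (i + m) + (∑ m f + ∑[ a ≤ m ] f (M ∸ a))                 ≡⟨ cong (∑[ i ≤ c ] f (i + m) +_) (sym (∑-distrib-+ f (λ a → f (M ∸ a)) m)) ⟩
  ∑[ i ≤ c ] f (i + m) + ∑[ a ≤ m ] (f a + f (M ∸ a))                   ∎
  where
  open ≡-Reasoning
  M = suc (m + (c + m))
  shape : ∀ i j → i + j ≡ suc m → M ≡ ((i + c) + m) + j
  shape i j i+j≡ = trans (cong (_+ (c + m)) (sym i+j≡)) (regroup i j c m)
    where
    regroup : ∀ i j c m → (i + j) + (c + m) ≡ ((i + c) + m) + j
    regroup = solve-∀
  mirror : ∀ i j → i + j ≡ suc m → f ((i + c) + m) ≡ f (M ∸ j)
  mirror i j i+j≡ = cong f (sym (trans (cong (_∸ j) (shape i j i+j≡)) (m+n∸n≡m _ j)))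

∑-monoʳ-≤ : ∀ f {m n} → m ≤ n → ∑ m f ≤ ∑ n f
∑-monoʳ-≤ f {m} m≤n with m≤n⇒∃[o]m+o≡n m≤n
... | o , refl = ≤-trans (m≤m+n (∑ m f) _) (≤-reflexive (sym (∑-split f m o)))

term-≤-∑ : ∀ f {a} K → 1 ≤ a → a ≤ K → f a ≤ ∑ K f
term-≤-∑ f {suc a} K _ a≤K = ≤-trans (m≤n+m (f (suc a)) (∑ a f)) (∑-monoʳ-≤ f a≤K)

δ : ℕ → ℕ → ℕ
δ zero    zero    = 1
δ zero    (suc y) = 0
δ (suc x) zero    = 0
δ (suc x) (suc y) = δ x y

δ-refl : ∀ x → δ x x ≡ 1
δ-refl zero    = refl
δ-refl (suc x) = δ-refl x

δ-≢ : ∀ {x y} → x ≢ y → δ x y ≡ 0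
δ-≢ {zero}  {zero}  x≢y = ⊥-elim (x≢y refl)
δ-≢ {zero}  {suc y} x≢y = refl
δ-≢ {suc x} {zero}  x≢y = refl
δ-≢ {suc x} {suc y} x≢y = δ-≢ (x≢y ∘ cong suc)

occ : List ℕ → ℕ → ℕ
occ []       x = 0
occ (y ∷ ys) x = δ x y + occ ys x

∈⇒occ≥1 : ∀ {x} ys → x ∈ ys → 1 ≤ occ ys x
∈⇒occ≥1 {x} (y ∷ ys) (here refl) = ≤-trans (≤-reflexive (sym (δ-refl x))) (m≤m+n _ _)
∈⇒occ≥1     (y ∷ ys) (there x∈)  = ≤-trans (∈⇒occ≥1 ys x∈) (m≤n+m _ _)

occ≥1⇒∈ : ∀ {x} ys → 1 ≤ occ ys x → x ∈ ys
occ≥1⇒∈ {x} (y ∷ ys) occ≥1 with x ≟ y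
... | yes x≡y = here x≡y
... | no  x≢y = there (occ≥1⇒∈ ys (subst (λ d → 1 ≤ d + occ ys x) (δ-≢ x≢y) occ≥1))

∉⇒occ≡0 : ∀ {x} ys → x ∉ ys → occ ys x ≡ 0
∉⇒occ≡0 {x} ys x∉ = n≤0⇒n≡0 (≮⇒≥ (x∉ ∘ occ≥1⇒∈ ys))

occ≡0⇒∉ : ∀ {x} ys → occ ys x ≡ 0 → x ∉ ys
occ≡0⇒∉ ys occ≡0 x∈ = 1+n≰n (subst (1 ≤_) occ≡0 (∈⇒occ≥1 ys x∈))

occ≗⇒⊆ : ∀ {xs ys} → (∀ x → occ xs x ≡ occ ys x) → ∀ {z} → z ∈ xs → z ∈ ys
occ≗⇒⊆ {xs} {ys} occ≗ {z} z∈ = occ≥1⇒∈ ys (subst (1 ≤_) (occ≗ z) (∈⇒occ≥1 xs z∈))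

∑-δ : ∀ M {y} → 1 ≤ y → y ≤ M → ∑[ x ≤ M ] x * δ x y ≡ y
∑-δ zero    (s≤s _) ()
∑-δ (suc M) {y} 1≤y y≤1+M with y ≟ suc M
... | yes refl = cong₂ _+_ (∑-zero M λ {x} _ x≤M → x*δ≡0 (<⇒≢ (s≤s x≤M)))
                          (trans (cong (suc M *_) (δ-refl (suc M))) (*-identityʳ (suc M)))
  where
  x*δ≡0 : ∀ {x y} → x ≢ y → x * δ x y ≡ 0
  x*δ≡0 {x} x≢y = trans (cong (x *_) (δ-≢ x≢y)) (*-zeroʳ x)
... | no  y≢1+M = trans (cong₂ _+_ (∑-δ M 1≤y (s≤s⁻¹ (≤∧≢⇒< y≤1+M y≢1+M)))
                                    (trans (cong (suc M *_) (δ-≢ (y≢1+M ∘ sym))) (*-zeroʳ (suc M))))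
                        (+-identityʳ y)

sum≡∑-occ : ∀ M ys → All (λ y → 1 ≤ y × y ≤ M) ys → sum ys ≡ ∑[ x ≤ M ] x * occ ys x
sum≡∑-occ M []       []              = sym (∑-zero M λ {x} _ _ → *-zeroʳ x)
sum≡∑-occ M (y ∷ ys) ((1≤y , y≤M) ∷ ys∈) = begin
  y + sum ys                                                  ≡⟨ cong₂ _+_ (sym (∑-δ M 1≤y y≤M)) (sum≡∑-occ M ys ys∈) ⟩
  ∑[ x ≤ M ] x * δ x y + ∑[ x ≤ M ] x * occ ys x              ≡⟨ sym (∑-distrib-+ _ _ M) ⟩
  ∑[ x ≤ M ] (x * δ x y + x * occ ys x)                       ≡⟨ ∑-cong M (λ {x} _ _ → sym (*-distribˡ-+ x (δ x y) (occ ys x))) ⟩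
  ∑[ x ≤ M ] x * occ (y ∷ ys) x                               ∎
  where open ≡-Reasoning

head<tail : ∀ {y ys} → Linked _<_ (y ∷ ys) → All (y <_) ys
head<tail y∷ys↗ with Linked⇒AllPairs <-trans y∷ys↗
... | y<ys ∷ _ = y<ys

↗-min : ∀ {y ys z} → Linked _<_ (y ∷ ys) → z ∈ y ∷ ys → y ≤ z
↗-min _     (here refl) = ≤-refl
↗-min y∷ys↗ (there z∈)  = <⇒≤ (All.lookup (head<tail y∷ys↗) z∈)

occ-≤1 : ∀ {ys} → Linked _<_ ys → ∀ x → occ ys x ≤ 1
occ-≤1 {[]}     _     x = z≤n
occ-≤1 {y ∷ ys} y∷ys↗ x with x ≟ y
... | yes refl = ≤-reflexive (cong₂ _+_ (δ-refl x) (∉⇒occ≡0 ys x∉ys))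
  where
  x∉ys : x ∉ ys
  x∉ys x∈ = <-irrefl refl (All.lookup (head<tail y∷ys↗) x∈)
... | no  x≢y = subst (λ d → d + occ ys x ≤ 1) (sym (δ-≢ x≢y)) (occ-≤1 (Linked.tail y∷ys↗) x)

↗-ext : ∀ {xs ys} → Linked _<_ xs → Linked _<_ ys →
        (∀ {z} → z ∈ xs → z ∈ ys) → (∀ {z} → z ∈ ys → z ∈ xs) → xs ≡ ys
↗-ext {[]}     {[]}     _ _ _ _ = refl
↗-ext {[]}     {y ∷ ys} _ _ _ ys⊆ with ys⊆ (here refl)
... | ()
↗-ext {x ∷ xs} {[]}     _ _ xs⊆ _ with xs⊆ (here refl)
... | ()
↗-ext {x ∷ xs} {y ∷ ys} xs↗ ys↗ xs⊆ ys⊆ =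
  cong₂ _∷_ x≡y (↗-ext (Linked.tail xs↗) (Linked.tail ys↗) (drop-head xs↗ x≡y xs⊆) (drop-head ys↗ (sym x≡y) ys⊆))
  where
  x≡y : x ≡ y
  x≡y = ≤-antisym (↗-min xs↗ (ys⊆ (here refl))) (↗-min ys↗ (xs⊆ (here refl)))
  drop-head : ∀ {u us v vs} → Linked _<_ (u ∷ us) → u ≡ v →
              (∀ {z} → z ∈ u ∷ us → z ∈ v ∷ vs) → ∀ {z} → z ∈ us → z ∈ vs
  drop-head u∷us↗ refl ⊆ z∈ with ⊆ (there z∈)
  ... | here refl = ⊥-elim (<-irrefl refl (All.lookup (head<tail u∷us↗) z∈))
  ... | there z∈′ = z∈′

≤-largest : ∀ xs → All (_≤ largest xs) xs
≤-largest []       = []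
≤-largest (x ∷ xs) = m≤m⊔n x (largest xs) ∷ All.map (λ y≤ → ≤-trans y≤ (m≤n⊔m x (largest xs))) (≤-largest xs)

largest-∈ : ∀ xs → 1 ≤ length xs → largest xs ∈ xs
largest-∈ (x ∷ [])     _ = here (⊔-identityʳ x)
largest-∈ (x ∷ y ∷ xs) _ =
  [ here , (λ x⊔l≡l → subst (_∈ x ∷ y ∷ xs) (sym x⊔l≡l) (there (largest-∈ (y ∷ xs) (s≤s z≤n)))) ]′
  (⊔-sel x (largest (y ∷ xs)))

largest-unique : ∀ {xs b} → All (_≤ b) xs → b ∈ xs → largest xs ≡ b
largest-unique {xs} xs≤b b∈ = ≤-antisym (largest≤ xs xs≤b) (All.lookup (≤-largest xs) b∈)
  where
  largest≤ : ∀ {b} xs → All (_≤ b) xs → largest xs ≤ b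
  largest≤ []       []           = z≤n
  largest≤ (x ∷ xs) (x≤b ∷ xs≤b) = ⊔-lub x≤b (largest≤ xs xs≤b)

module DistinctParts {N λs} (P : DistinctPartition N λs) where
  open DistinctPartition P

  largest-part : largest λs ∈ λs
  largest-part = largest-∈ λs (≤-trans (s≤s z≤n) atLeastTwo)

  sum-by-occ : N ≡ ∑[ x ≤ largest λs ] x * occ λs x
  sum-by-occ = trans (sym sums) (sum≡∑-occ (largest λs) λs (All.zip (positive , ≤-largest λs)))

  occ-binary : ∀ x → occ λs x ≡ 0 ⊎ occ λs x ≡ 1
  occ-binary x = n≤1⇒n≡0∨n≡1 (occ-≤1 increasing x)

  occ-part : ∀ {x} → x ∈ λs → occ λs x ≡ 1
  occ-part {x} x∈ = ≤-antisym (occ-≤1 increasing x) (∈⇒occ≥1 λs x∈)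

  occ-largest : occ λs (largest λs) ≡ 1
  occ-largest = occ-part largest-part

  occ-zero : occ λs 0 ≡ 0
  occ-zero = ∉⇒occ≡0 λs λ 0∈ → 1+n≰n (All.lookup positive 0∈)

  occ-above : ∀ {x} → largest λs < x → occ λs x ≡ 0
  occ-above M<x = ∉⇒occ≡0 λs λ x∈ → <⇒≱ M<x (All.lookup (≤-largest λs) x∈)

pairWeight : List ℕ → ℕ → ℕ
pairWeight λs a = a * occ λs a + (largest λs ∸ a) * occ λs (largest λs ∸ a)

pairExcess : List ℕ → ℕ → ℕ
pairExcess λs a = pairWeight λs a ∸ a

data PairStatus (λs : List ℕ) (a t : ℕ) : Set where
  lowerOnly : occ λs a ≡ 1 → occ λs (t + a) ≡ 0 → PairStatus λs a t
  upperOnly : occ λs a ≡ 0 → occ λs (t + a) ≡ 1 → PairStatus λs a t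
  both      : occ λs a ≡ 1 → occ λs (t + a) ≡ 1 → PairStatus λs a t

statusExcess : ∀ {λs a t} → PairStatus λs a t → ℕ
statusExcess         (lowerOnly _ _) = 0
statusExcess {t = t} (upperOnly _ _) = t
statusExcess {a = a} {t} (both _ _)  = t + a

-- Unrefinability excludes the fourth case: a and t + a both missing, while their sum is a part.
pairStatus : ∀ {N λs a t} → InU N λs → 1 ≤ a → 1 ≤ t → largest λs ≡ a + (t + a) → PairStatus λs a t
pairStatus {λs = λs} {a} {t} (P , unrefinable) 1≤a 1≤t M≡ with DistinctParts.occ-binary P a | DistinctParts.occ-binary P (t + a)
... | inj₁ a-missing | inj₁ b-missing = ⊥-elim (unrefinable
        (a , t + a , <⇒≢ (m<n+m a 1≤t)
        , (1≤a , subst (a ≤_) (sym M≡) (m≤m+n a _) , occ≡0⇒∉ λs a-missing)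
        , (≤-trans 1≤a (m≤n+m a t) , subst (t + a ≤_) (sym M≡) (m≤n+m _ a) , occ≡0⇒∉ λs b-missing)
        , subst (_∈ λs) M≡ (largest-part P)))
  where open DistinctParts using (largest-part)
... | inj₁ a-missing | inj₂ b-present = upperOnly a-missing b-present
... | inj₂ a-present | inj₁ b-missing = lowerOnly a-present b-missing
... | inj₂ a-present | inj₂ b-present = both a-present b-present

pairWeight-status : ∀ {λs a t} → largest λs ≡ a + (t + a) → (s : PairStatus λs a t) →
                    pairWeight λs a ≡ a + statusExcess s
pairWeight-status {λs} {a} {t} M≡ s rewrite trans (cong (_∸ a) M≡) (m+n∸m≡n a (t + a)) with s
... | lowerOnly a-present b-missing rewrite a-present | b-missing = cong₂ _+_ (*-identityʳ a) (*-zeroʳ (t + a))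
... | upperOnly a-missing b-present rewrite a-missing | b-present = trans (cong₂ _+_ (*-zeroʳ a) (*-identityʳ (t + a))) (+-comm t a)
... | both      a-present b-present rewrite a-present | b-present = cong₂ _+_ (*-identityʳ a) (*-identityʳ (t + a))

pairExcess-status : ∀ {λs a t} → largest λs ≡ a + (t + a) → (s : PairStatus λs a t) →
                    pairExcess λs a ≡ statusExcess s
pairExcess-status {a = a} M≡ s = trans (cong (_∸ a) (pairWeight-status M≡ s)) (m+n∸m≡n a (statusExcess s))

complementary-offset : ∀ {a d m} c → a + d ≡ m → suc (m + (c + m)) ≡ a + (suc (d + (c + d)) + a)
complementary-offset {a} {d} c refl = regroup a d c
  where
  regroup : ∀ a d c → suc ((a + d) + (c + (a + d))) ≡ a + (suc (d + (c + d)) + a)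
  regroup = solve-∀

pairStatus-below : ∀ {N λs a d m} c → InU N λs → largest λs ≡ suc (m + (c + m)) → 1 ≤ a → a + d ≡ m →
                   Σ (PairStatus λs a (suc (d + (c + d)))) λ s → pairExcess λs a ≡ statusExcess s
pairStatus-below c u M≡ 1≤a a+d≡m = s , pairExcess-status M≡′ s
  where
  M≡′ = trans M≡ (complementary-offset c a+d≡m)
  s = pairStatus u 1≤a (s≤s z≤n) M≡′

-- The values 1, …, largest − 1 are read in pairs a, largest − a with 1 ≤ a ≤ m; the c values
-- between the two halves stay unpaired.
sum-decomposition : ∀ {N λs} m c → InU N λs → largest λs ≡ suc (m + (c + m)) →
  N ≡ ∑[ i ≤ c ] (i + m) * occ λs (i + m) + (tri m + ∑[ a ≤ m ] pairExcess λs a) + largest λs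
sum-decomposition {N} {λs} m c u@(P , _) M≡ = begin
  N                                                                      ≡⟨ sum-by-occ ⟩
  ∑[ x ≤ largest λs ] x * occ λs x                                       ≡⟨ cong (λ K → ∑ K g) M≡ ⟩
  ∑ (m + (c + m)) g + g (suc (m + (c + m)))                              ≡⟨ cong₂ _+_ (∑-pairing g m c) top ⟩
  ∑[ i ≤ c ] g (i + m) + ∑[ a ≤ m ] (g a + g (suc (m + (c + m)) ∸ a)) + M  ≡⟨ cong (λ s → ∑[ i ≤ c ] g (i + m) + s + M) (∑-cong m paired) ⟩
  ∑[ i ≤ c ] g (i + m) + ∑[ a ≤ m ] (a + pairExcess λs a) + M             ≡⟨ cong (λ s → ∑[ i ≤ c ] g (i + m) + s + M) (∑-distrib-+ (λ a → a) (pairExcess λs) m) ⟩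
  ∑[ i ≤ c ] g (i + m) + (tri m + ∑[ a ≤ m ] pairExcess λs a) + M         ∎
  where
  open ≡-Reasoning
  open DistinctParts P
  M = largest λs
  g = λ x → x * occ λs x
  top : g (suc (m + (c + m))) ≡ M
  top = trans (cong g (sym M≡)) (trans (cong (M *_) occ-largest) (*-identityʳ M))
  paired : ∀ {a} → 1 ≤ a → a ≤ m → g a + g (suc (m + (c + m)) ∸ a) ≡ a + pairExcess λs a
  paired {a} 1≤a a≤m with m≤n⇒∃[o]m+o≡n a≤m
  ... | d , a+d≡m = begin
    g a + g (suc (m + (c + m)) ∸ a)     ≡⟨ cong (λ K → g a + g (K ∸ a)) (sym M≡) ⟩
    pairWeight λs a                     ≡⟨ pairWeight-status M≡′ s ⟩
    a + statusExcess s                  ≡⟨ cong (a +_) (sym (pairExcess-status M≡′ s)) ⟩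
    a + pairExcess λs a                 ∎
    where
    M≡′ = trans M≡ (complementary-offset c a+d≡m)
    s = pairStatus u 1≤a (s≤s z≤n) M≡′

sum-lower-bound : ∀ {N λs} m c → InU N λs → largest λs ≡ suc (m + (c + m)) → tri m + largest λs ≤ N
sum-lower-bound {N} {λs} m c u M≡ = begin
  tri m + largest λs              ≤⟨ +-monoˡ-≤ (largest λs) (≤-trans (m≤m+n (tri m) S) (m≤n+m (tri m + S) X)) ⟩
  X + (tri m + S) + largest λs    ≡⟨ sym (sum-decomposition m c u M≡) ⟩
  N                               ∎
  where
  open ≤-Reasoning
  S = ∑[ a ≤ m ] pairExcess λs a
  X = ∑[ i ≤ c ] (i + m) * occ λs (i + m)

excess-even-or-large : ∀ {N λs a m} → InU N λs → largest λs ≡ suc (m + (1 + m)) → 1 ≤ a → a ≤ m →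
                       2 ∣ pairExcess λs a ⊎ 2 + m ≤ pairExcess λs a
excess-even-or-large {λs = λs} {a} {m} u M≡ 1≤a a≤m with m≤n⇒∃[o]m+o≡n a≤m
... | d , a+d≡m with pairStatus-below 1 u M≡ 1≤a a+d≡m
... | lowerOnly _ _ , E≡0 = inj₁ (subst (2 ∣_) (sym E≡0) (2 ∣0))
... | upperOnly _ _ , E≡t = inj₁ (subst (2 ∣_) (sym E≡t) (divides (suc d) (double d)))
  where
  double : ∀ d → suc (d + (1 + d)) ≡ suc d * 2
  double = solve-∀
... | both _ _      , E≡b = inj₂ (begin
  2 + m                    ≡⟨ cong (2 +_) (sym a+d≡m) ⟩
  2 + (a + d)              ≤⟨ m≤m+n _ d ⟩
  2 + (a + d) + d          ≡⟨ regroup a d ⟩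
  suc (d + (1 + d)) + a    ≡⟨ sym E≡b ⟩
  pairExcess λs a          ∎)
  where
  open ≤-Reasoning
  regroup : ∀ a d → 2 + (a + d) + d ≡ suc (d + (1 + d)) + a
  regroup = solve-∀

-- For n = 11 + k: total k = T_{n,n−6} and maxPart k = 2n − 5.
total : ℕ → ℕ
total k = tri (8 + k) + (25 + (k + k))

maxPart : ℕ → ℕ
maxPart k = suc ((8 + k) + (8 + k))

-- All excesses would be even, but they have to sum to 7.
largest≢18+2k : ∀ {k λs} → InU (total k) λs → largest λs ≢ 18 + (k + k)
largest≢18+2k {k} {λs} u@(P , _) M≡ = from-no (2 ∣? 7) (subst (2 ∣_) S≡7 (∑-divisible m even))
  where
  open DistinctParts P
  m = 8 + k
  S = ∑[ a ≤ m ] pairExcess λs a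
  X = (9 + k) * occ λs (9 + k)
  M≡′ : largest λs ≡ suc (m + (1 + m))
  M≡′ = trans M≡ (regroup k)
    where
    regroup : ∀ k → 18 + (k + k) ≡ suc ((8 + k) + (1 + (8 + k)))
    regroup = solve-∀
  X+S≡7 : X + S ≡ 7
  X+S≡7 = sym (+-cancelʳ-≡ (tri m + (18 + (k + k))) 7 (X + S) (begin
    7 + (tri m + (18 + (k + k)))         ≡⟨ shuffle₁ (tri m) k ⟩
    total k                              ≡⟨ sum-decomposition m 1 u M≡′ ⟩
    X + (tri m + S) + largest λs         ≡⟨ cong (X + (tri m + S) +_) M≡ ⟩
    X + (tri m + S) + (18 + (k + k))     ≡⟨ shuffle₂ X (tri m) S k ⟩
    (X + S) + (tri m + (18 + (k + k)))   ∎))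
    where
    open ≡-Reasoning
    shuffle₁ : ∀ T k → 7 + (T + (18 + (k + k))) ≡ T + (25 + (k + k))
    shuffle₁ = solve-∀
    shuffle₂ : ∀ X T S k → X + (T + S) + (18 + (k + k)) ≡ (X + S) + (T + (18 + (k + k)))
    shuffle₂ = solve-∀
  S≤7 : S ≤ 7
  S≤7 = subst (S ≤_) X+S≡7 (m≤n+m S X)
  S≡7 : S ≡ 7
  S≡7 with occ-binary (9 + k)
  ... | inj₁ middle-missing = trans (sym (cong (_+ S) (trans (cong ((9 + k) *_) middle-missing) (*-zeroʳ (9 + k))))) X+S≡7
  ... | inj₂ middle-present = ⊥-elim (from-no (9 ≤? 7) (m+n≤o⇒m≤o 9 (begin
    9 + k                            ≡⟨ sym (*-identityʳ (9 + k)) ⟩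
    (9 + k) * 1                      ≡⟨ cong ((9 + k) *_) (sym middle-present) ⟩
    X                                ≤⟨ m≤m+n X S ⟩
    X + S                            ≡⟨ X+S≡7 ⟩
    7                                ∎)))
    where open ≤-Reasoning
  even : ∀ {a} → 1 ≤ a → a ≤ m → 2 ∣ pairExcess λs a
  even 1≤a a≤m = [ id , (λ large → ⊥-elim (from-no (10 ≤? 7) (m+n≤o⇒m≤o 10
    (≤-trans large (≤-trans (term-≤-∑ (pairExcess λs) m 1≤a a≤m) S≤7))))) ]′
    (excess-even-or-large u M≡′ 1≤a a≤m)

largest≯18+2k : ∀ {k λs} → InU (total k) λs → ¬ (18 + (k + k) < largest λs)
largest≯18+2k {k} {λs} u 19+2k≤M = beyond (m≤n⇒∃[o]m+o≡n 19+2k≤M)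
  where
  beyond : ∃ (λ c → 19 + (k + k) + c ≡ largest λs) → ⊥
  beyond (c , 19+2k+c≡M) = <-irrefl refl (begin-strict
    total k                         <⟨ ≤-trans (m≤m+n _ (2 + k)) (≤-reflexive (gap (tri (8 + k)) k)) ⟩
    tri (9 + k) + (19 + (k + k))    ≤⟨ +-monoʳ-≤ (tri (9 + k)) 19+2k≤M ⟩
    tri (9 + k) + largest λs        ≤⟨ sum-lower-bound (9 + k) c u (trans (sym 19+2k+c≡M) (regroup k c)) ⟩
    total k                         ∎)
    where
    open ≤-Reasoning
    gap : ∀ T k → suc (T + (25 + (k + k))) + (2 + k) ≡ T + (9 + k) + (19 + (k + k))
    gap = solve-∀
    regroup : ∀ k c → 19 + (k + k) + c ≡ suc ((9 + k) + (c + (9 + k)))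
    regroup = solve-∀

largest≤maxPart : ∀ {k λs} → InU (total k) λs → largest λs ≤ maxPart k
largest≤maxPart {k} {λs} u with <-cmp (largest λs) (18 + (k + k))
... | tri< M<18+2k _ _ = ≤-trans (s≤s⁻¹ M<18+2k) (≤-reflexive (regroup k))
  where
  regroup : ∀ k → 17 + (k + k) ≡ suc ((8 + k) + (8 + k))
  regroup = solve-∀
... | tri≈ _ M≡18+2k _ = ⊥-elim (largest≢18+2k u M≡18+2k)
... | tri> _ _ M>18+2k = ⊥-elim (largest≯18+2k u M>18+2k)

Bit : ℕ → Set
Bit b = b ≡ 0 ⊎ b ≡ 1

subsum-7531≡8 : ∀ {b₀ b₁ b₂ b₃} → Bit b₀ → Bit b₁ → Bit b₂ → Bit b₃ →
  7 * b₀ + 5 * b₁ + 3 * b₂ + 1 * b₃ ≡ 8 →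
  (b₀ , b₁ , b₂ , b₃) ≡ (0 , 1 , 1 , 0) ⊎ (b₀ , b₁ , b₂ , b₃) ≡ (1 , 0 , 0 , 1)
subsum-7531≡8 (inj₁ refl) (inj₁ refl) (inj₁ refl) (inj₁ refl) ()
subsum-7531≡8 (inj₁ refl) (inj₁ refl) (inj₁ refl) (inj₂ refl) ()
subsum-7531≡8 (inj₁ refl) (inj₁ refl) (inj₂ refl) (inj₁ refl) ()
subsum-7531≡8 (inj₁ refl) (inj₁ refl) (inj₂ refl) (inj₂ refl) ()
subsum-7531≡8 (inj₁ refl) (inj₂ refl) (inj₁ refl) (inj₁ refl) ()
subsum-7531≡8 (inj₁ refl) (inj₂ refl) (inj₁ refl) (inj₂ refl) ()
subsum-7531≡8 (inj₁ refl) (inj₂ refl) (inj₂ refl) (inj₁ refl) _  = inj₁ refl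
subsum-7531≡8 (inj₁ refl) (inj₂ refl) (inj₂ refl) (inj₂ refl) ()
subsum-7531≡8 (inj₂ refl) (inj₁ refl) (inj₁ refl) (inj₁ refl) ()
subsum-7531≡8 (inj₂ refl) (inj₁ refl) (inj₁ refl) (inj₂ refl) _  = inj₂ refl
subsum-7531≡8 (inj₂ refl) (inj₁ refl) (inj₂ refl) (inj₁ refl) ()
subsum-7531≡8 (inj₂ refl) (inj₁ refl) (inj₂ refl) (inj₂ refl) ()
subsum-7531≡8 (inj₂ refl) (inj₂ refl) (inj₁ refl) (inj₁ refl) ()
subsum-7531≡8 (inj₂ refl) (inj₂ refl) (inj₁ refl) (inj₂ refl) ()
subsum-7531≡8 (inj₂ refl) (inj₂ refl) (inj₂ refl) (inj₁ refl) ()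
subsum-7531≡8 (inj₂ refl) (inj₂ refl) (inj₂ refl) (inj₂ refl) ()

subsum-7531-determined : ∀ {x y : ℕ × ℕ × ℕ × ℕ} →
  x ≡ (0 , 1 , 1 , 0) ⊎ x ≡ (1 , 0 , 0 , 1) → y ≡ (0 , 1 , 1 , 0) ⊎ y ≡ (1 , 0 , 0 , 1) →
  proj₁ x ≡ proj₁ y → x ≡ y
subsum-7531-determined (inj₁ refl) (inj₁ refl) _  = refl
subsum-7531-determined (inj₂ refl) (inj₂ refl) _  = refl
subsum-7531-determined (inj₁ refl) (inj₂ refl) ()
subsum-7531-determined (inj₂ refl) (inj₁ refl) ()

module AtMaximum {k λs} (u : InU (total k) λs) (top : largest λs ≡ maxPart k) where
  open DistinctParts (proj₁ u) public

  excess-sum : ∑[ a ≤ 8 + k ] pairExcess λs a ≡ 8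
  excess-sum = sym (+-cancelʳ-≡ (tri (8 + k) + (17 + (k + k))) 8 S (begin
    8 + (tri (8 + k) + (17 + (k + k)))     ≡⟨ shuffle₁ (tri (8 + k)) k ⟩
    total k                                ≡⟨ sum-decomposition (8 + k) 0 u top ⟩
    tri (8 + k) + S + largest λs           ≡⟨ cong (tri (8 + k) + S +_) top ⟩
    tri (8 + k) + S + maxPart k            ≡⟨ shuffle₂ (tri (8 + k)) S k ⟩
    S + (tri (8 + k) + (17 + (k + k)))     ∎))
    where
    open ≡-Reasoning
    S = ∑[ a ≤ 8 + k ] pairExcess λs a
    shuffle₁ : ∀ T k → 8 + (T + (17 + (k + k))) ≡ T + (25 + (k + k))
    shuffle₁ = solve-∀
    shuffle₂ : ∀ T S k → T + S + suc ((8 + k) + (8 + k)) ≡ S + (T + (17 + (k + k)))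
    shuffle₂ = solve-∀

  excess-≤8 : ∀ {a} → 1 ≤ a → a ≤ 8 + k → pairExcess λs a ≤ 8
  excess-≤8 1≤a a≤ = ≤-trans (term-≤-∑ (pairExcess λs) (8 + k) 1≤a a≤) (≤-reflexive excess-sum)

  -- A pair with both members present would carry the excess 9 + k + d > 8.
  complementary : ∀ {a d} → 1 ≤ a → a + d ≡ 8 + k →
    occ λs a + occ λs (suc (d + d) + a) ≡ 1 × pairExcess λs a ≡ suc (d + d) * occ λs (suc (d + d) + a)
  complementary {a} {d} 1≤a a+d≡ with pairStatus-below 0 u top 1≤a a+d≡
  ... | lowerOnly a-present b-missing , E≡0 =
    cong₂ _+_ a-present b-missing , trans E≡0 (sym (trans (cong (suc (d + d) *_) b-missing) (*-zeroʳ (suc (d + d)))))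
  ... | upperOnly a-missing b-present , E≡t =
    cong₂ _+_ a-missing b-present , trans E≡t (sym (trans (cong (suc (d + d) *_) b-present) (*-identityʳ (suc (d + d)))))
  ... | both _ _ , E≡b = ⊥-elim (from-no (9 ≤? 8) (m+n≤o⇒m≤o 9 (begin
    9 + k                     ≡⟨ cong suc (trans (sym a+d≡) (+-comm a d)) ⟩
    suc (d + a)               ≤⟨ s≤s (+-monoˡ-≤ a (m≤m+n d d)) ⟩
    suc (d + d) + a           ≡⟨ sym E≡b ⟩
    pairExcess λs a           ≤⟨ excess-≤8 1≤a (subst (a ≤_) a+d≡ (m≤m+n a d)) ⟩
    8                         ∎)))
    where open ≤-Reasoning

  lower-quarter : ∀ {a} → 1 ≤ a → a ≤ 4 + k → occ λs a ≡ 1 × pairExcess λs a ≡ 0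
  lower-quarter {a} 1≤a a≤4+k with m≤n⇒∃[o]m+o≡n (≤-trans a≤4+k (m≤n+m (4 + k) 4))
  ... | d , a+d≡ with complementary 1≤a a+d≡ | occ-binary (suc (d + d) + a)
  ... | sum≡1 , E≡ | inj₁ b-missing =
    trans (sym (+-identityʳ _)) (trans (cong (occ λs a +_) (sym b-missing)) sum≡1) ,
    trans E≡ (trans (cong (suc (d + d) *_) b-missing) (*-zeroʳ (suc (d + d))))
  ... | sum≡1 , E≡ | inj₂ b-present = ⊥-elim (from-no (9 ≤? 8) (begin
    9                         ≤⟨ s≤s (+-mono-≤ 4≤d 4≤d) ⟩
    suc (d + d)               ≡⟨ sym (*-identityʳ (suc (d + d))) ⟩
    suc (d + d) * 1           ≡⟨ cong (suc (d + d) *_) (sym b-present) ⟩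
    suc (d + d) * occ λs (suc (d + d) + a)     ≡⟨ sym E≡ ⟩
    pairExcess λs a           ≤⟨ excess-≤8 1≤a (subst (a ≤_) a+d≡ (m≤m+n a d)) ⟩
    8                         ∎))
    where
    open ≤-Reasoning
    4≤d : 4 ≤ d
    4≤d = +-cancelˡ-≤ (4 + k) 4 d (≤-trans (≤-reflexive (trans (+-comm (4 + k) 4) (sym a+d≡))) (+-monoˡ-≤ d a≤4+k))

  -- The partners of 5 + k, …, 8 + k; the excesses there are 7, 5, 3, 1 times these bits.
  upperBits : ℕ × ℕ × ℕ × ℕ
  upperBits = occ λs (12 + k) , occ λs (11 + k) , occ λs (10 + k) , occ λs (9 + k)

  upperBits-weight : 7 * occ λs (12 + k) + 5 * occ λs (11 + k) + 3 * occ λs (10 + k) + 1 * occ λs (9 + k) ≡ 8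
  upperBits-weight = begin
    7 * occ λs (12 + k) + 5 * occ λs (11 + k) + 3 * occ λs (10 + k) + 1 * occ λs (9 + k)
      ≡⟨ sym (cong₂ _+_ (cong₂ _+_ (cong₂ _+_ (E≡ 3 (+-comm (5 + k) 3)) (E≡ 2 (+-comm (6 + k) 2)))
                                               (E≡ 1 (+-comm (7 + k) 1))) (E≡ 0 (+-identityʳ (8 + k)))) ⟩
    ∑[ i ≤ 4 ] E (i + (4 + k))
      ≡⟨ sym (cong (_+ ∑[ i ≤ 4 ] E (i + (4 + k))) (∑-zero (4 + k) λ 1≤a a≤ → proj₂ (lower-quarter 1≤a a≤))) ⟩
    ∑ (4 + k) E + ∑[ i ≤ 4 ] E (i + (4 + k))
      ≡⟨ sym (∑-split E (4 + k) 4) ⟩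
    ∑ ((4 + k) + 4) E
      ≡⟨ cong (λ K → ∑ K E) (+-comm (4 + k) 4) ⟩
    ∑ (8 + k) E
      ≡⟨ excess-sum ⟩
    8 ∎
    where
    open ≡-Reasoning
    E = pairExcess λs
    E≡ : ∀ {a} d → suc a + d ≡ 8 + k → E (suc a) ≡ suc (d + d) * occ λs (suc (d + d) + suc a)
    E≡ d a+d≡ = proj₂ (complementary (s≤s z≤n) a+d≡)

  upperBits-cases : upperBits ≡ (0 , 1 , 1 , 0) ⊎ upperBits ≡ (1 , 0 , 0 , 1)
  upperBits-cases = subsum-7531≡8 (occ-binary _) (occ-binary _) (occ-binary _) (occ-binary _) upperBits-weight

upper-half-partner : ∀ {m x} → m < x → x ≤ m + m →
                     ∃ λ a → ∃ λ d → 1 ≤ a × a + d ≡ m × suc (d + d) + a ≡ x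
upper-half-partner {m} m<x x≤2m with m≤n⇒∃[o]m+o≡n m<x
... | d , refl with m≤n⇒∃[o]m+o≡n (+-cancelˡ-≤ m (suc d) m (≤-trans (≤-reflexive (+-suc m d)) x≤2m))
... | e , refl = suc e , d , s≤s z≤n , cong suc (+-comm e d) , regroup d e
  where
  regroup : ∀ d e → suc (d + d) + suc e ≡ suc (suc d + e) + d
  regroup = solve-∀

unique-at-maximum : ∀ {k λs μs} (u : InU (total k) λs) (v : InU (total k) μs) →
  largest λs ≡ maxPart k → largest μs ≡ maxPart k → occ λs (5 + k) ≡ occ μs (5 + k) → λs ≡ μs
unique-at-maximum {k} {λs} {μs} u v λ-top μ-top same-at-5+k =
  ↗-ext (increasing (proj₁ u)) (increasing (proj₁ v)) (occ≗⇒⊆ occ≗) (occ≗⇒⊆ (sym ∘ occ≗))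
  where
  open DistinctPartition using (increasing)
  module Λ = AtMaximum u λ-top
  module Μ = AtMaximum v μ-top

  complement-unique : ∀ {x y z} → x + y ≡ 1 → x + z ≡ 1 → y ≡ z
  complement-unique {x} x+y≡1 x+z≡1 = +-cancelˡ-≡ x _ _ (trans x+y≡1 (sym x+z≡1))

  lower-from-partner : ∀ {a d} → 1 ≤ a → a + d ≡ 8 + k →
    occ λs (suc (d + d) + a) ≡ occ μs (suc (d + d) + a) → occ λs a ≡ occ μs a
  lower-from-partner {a} {d} 1≤a a+d≡ partner≡ = +-cancelʳ-≡ (occ μs (suc (d + d) + a)) _ _ (trans
    (trans (cong (occ λs a +_) (sym partner≡)) (proj₁ (Λ.complementary 1≤a a+d≡)))
    (sym (proj₁ (Μ.complementary 1≤a a+d≡))))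

  partner-from-lower : ∀ {a d} → 1 ≤ a → a + d ≡ 8 + k →
    occ λs a ≡ occ μs a → occ λs (suc (d + d) + a) ≡ occ μs (suc (d + d) + a)
  partner-from-lower {a} 1≤a a+d≡ a≡ = complement-unique (proj₁ (Λ.complementary 1≤a a+d≡))
    (trans (cong (_+ _) a≡) (proj₁ (Μ.complementary 1≤a a+d≡)))

  bits≡ : Λ.upperBits ≡ Μ.upperBits
  bits≡ = subsum-7531-determined Λ.upperBits-cases Μ.upperBits-cases
            (partner-from-lower (s≤s z≤n) (+-comm (5 + k) 3) same-at-5+k)

  lower-half : ∀ {a} → 1 ≤ a → a ≤ 8 + k → occ λs a ≡ occ μs a
  lower-half {a} 1≤a a≤8+k with a ≤? 4 + k
  ... | yes a≤4+k = trans (proj₁ (Λ.lower-quarter 1≤a a≤4+k)) (sym (proj₁ (Μ.lower-quarter 1≤a a≤4+k)))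
  ... | no  a≰4+k with m≤n⇒∃[o]m+o≡n (≰⇒> a≰4+k)
  ... | j , 5+k+j≡a with trans (+-comm j (5 + k)) 5+k+j≡a
  ... | refl = top-quarter j a≤8+k
    where
    top-quarter : ∀ j → j + (5 + k) ≤ 8 + k → occ λs (j + (5 + k)) ≡ occ μs (j + (5 + k))
    top-quarter 0 _ = same-at-5+k
    top-quarter 1 _ = lower-from-partner (s≤s z≤n) (+-comm (6 + k) 2) (cong (proj₁ ∘ proj₂) bits≡)
    top-quarter 2 _ = lower-from-partner (s≤s z≤n) (+-comm (7 + k) 1) (cong (proj₁ ∘ proj₂ ∘ proj₂) bits≡)
    top-quarter 3 _ = lower-from-partner (s≤s z≤n) (+-comm (8 + k) 0) (cong (proj₂ ∘ proj₂ ∘ proj₂) bits≡)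
    top-quarter (suc (suc (suc (suc j)))) j+5+k≤8+k = ⊥-elim (<-irrefl refl (≤-trans (+-monoʳ-≤ 4 (m≤n+m (5 + k) j)) j+5+k≤8+k))

  occ≗ : ∀ x → occ λs x ≡ occ μs x
  occ≗ zero = trans Λ.occ-zero (sym Μ.occ-zero)
  occ≗ x@(suc _) with x ≤? 8 + k
  ... | yes x≤8+k = lower-half (s≤s z≤n) x≤8+k
  ... | no  x≰8+k with x ≤? (8 + k) + (8 + k)
  ... | yes x≤16+2k with upper-half-partner (≰⇒> x≰8+k) x≤16+2k
  ... | a , d , 1≤a , a+d≡ , refl = partner-from-lower 1≤a a+d≡ (lower-half 1≤a (subst (a ≤_) a+d≡ (m≤m+n a d)))
  occ≗ x@(suc _) | no _ | no x≰16+2k with x ≟ maxPart k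
  ... | yes refl = trans (subst (λ y → occ λs y ≡ 1) λ-top Λ.occ-largest) (sym (subst (λ y → occ μs y ≡ 1) μ-top Μ.occ-largest))
  ... | no  x≢top = trans (Λ.occ-above (subst (_< x) (sym λ-top) top<x)) (sym (Μ.occ-above (subst (_< x) (sym μ-top) top<x)))
    where
    top<x : maxPart k < x
    top<x = ≤∧≢⇒< (≰⇒> x≰16+2k) (x≢top ∘ sym)

oneTo : ℕ → List ℕ
oneTo = applyUpTo suc

sum-oneTo : ∀ n → sum (oneTo n) ≡ tri n
sum-oneTo zero    = refl
sum-oneTo (suc n) = begin
  sum (oneTo (suc n))              ≡⟨ cong sum (sym (applyUpTo-∷ʳ suc n)) ⟩
  sum (oneTo n ++ suc n ∷ [])      ≡⟨ sum-++ (oneTo n) (suc n ∷ []) ⟩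
  sum (oneTo n) + (suc n + 0)      ≡⟨ cong₂ _+_ (sum-oneTo n) (+-identityʳ (suc n)) ⟩
  tri (suc n)                      ∎
  where open ≡-Reasoning

∈-oneTo⁺ : ∀ {n x} → 1 ≤ x → x ≤ n → x ∈ oneTo n
∈-oneTo⁺ {x = suc i} _ i<n = ∈-applyUpTo⁺ suc i<n

∈-oneTo⁻ : ∀ {n x} → x ∈ oneTo n → 1 ≤ x × x ≤ n
∈-oneTo⁻ x∈ with ∈-applyUpTo⁻ suc x∈
... | i , i<n , refl = s≤s z≤n , i<n

prefixed-partition : ∀ n {t} → Linked _<_ t → All (n <_) t → 2 ≤ length t →
                     DistinctPartition (tri n + sum t) (oneTo n ++ t)
prefixed-partition n {t} t↗ n<t 2≤|t| = record
  { increasing = AllPairs⇒Linked (AllPairs.++⁺ (Linked⇒AllPairs <-trans (applyUpTo⁺₂ suc n λ i → ≤-refl))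
                                               (Linked⇒AllPairs <-trans t↗)
                                               (All.tabulate λ x∈ → All.map (≤-<-trans (proj₂ (∈-oneTo⁻ x∈))) n<t))
  ; positive   = All-++⁺ (All.tabulate (proj₁ ∘ ∈-oneTo⁻)) (All.map (≤-<-trans z≤n) n<t)
  ; sums       = trans (sum-++ (oneTo n) t) (cong (_+ sum t) (sum-oneTo n))
  ; atLeastTwo = ≤-trans 2≤|t| (≤-trans (m≤n+m (length t) n)
                   (≤-reflexive (sym (trans (length-++ (oneTo n)) (cong (_+ length t) (length-applyUpTo suc n))))))
  }

largest-prefixed : ∀ {n t M} → All (_≤ M) t → M ∈ t → n ≤ M → largest (oneTo n ++ t) ≡ M
largest-prefixed t≤M M∈t n≤M =
  largest-unique (All-++⁺ (All.tabulate λ x∈ → ≤-trans (proj₂ (∈-oneTo⁻ x∈)) n≤M) t≤M) (∈-++⁺ʳ _ M∈t)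

prefixed-unrefinable : ∀ n {t} → (∀ {x y} → n < x → n < y → x ≢ y → x ∉ t → y ∉ t → x + y ∉ t) →
                       Unrefinable (oneTo n ++ t)
prefixed-unrefinable n {t} no-sum (x , y , x≢y , (1≤x , _ , x∉) , (1≤y , _ , y∉) , x+y∈) =
  no-sum n<x n<y x≢y (x∉ ∘ ∈-++⁺ʳ (oneTo n)) (y∉ ∘ ∈-++⁺ʳ (oneTo n)) x+y∈t
  where
  above : ∀ {z} → 1 ≤ z → z ∉ oneTo n ++ t → n < z
  above 1≤z z∉ = ≰⇒> λ z≤n → z∉ (∈-++⁺ˡ (∈-oneTo⁺ 1≤z z≤n))
  n<x = above 1≤x x∉
  n<y = above 1≤y y∉
  x+y∈t : x + y ∈ t
  x+y∈t with ∈-++⁻ (oneTo n) x+y∈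
  ... | inj₁ x+y∈oneTo = ⊥-elim (<⇒≱ n<x (≤-trans (m≤m+n x y) (proj₂ (∈-oneTo⁻ x+y∈oneTo))))
  ... | inj₂ x+y∈t′    = x+y∈t′

m<n⇒∃[o]o+1+m≡n : ∀ {m n} → m < n → ∃ λ o → o + suc m ≡ n
m<n⇒∃[o]o+1+m≡n {m} m<n with m≤n⇒∃[o]m+o≡n m<n
... | o , 1+m+o≡n = o , trans (+-comm o (suc m)) 1+m+o≡n

shifted-sum : ∀ c k i j → i + (c + k) + (j + (c + k)) ≡ (c + c + k) + (i + j + k)
shifted-sum = solve-∀

shifted-sum-≢ : ∀ c k a i j → True (a <? c + c) → i + (c + k) + (j + (c + k)) ≢ a + k
shifted-sum-≢ c k a i j a<2c eq = <⇒≱ (toWitness a<2c)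
  (+-cancelʳ-≤ k (c + c) a (≤-trans (m≤m+n (c + c + k) (i + j + k)) (≤-reflexive (trans (sym (shifted-sum c k i j)) eq))))

shifted-sum-≡ : ∀ c k a i j → i + (c + k) + (j + (c + k)) ≡ (c + c + k) + (a + k) → i + j ≡ a
shifted-sum-≡ c k a i j eq =
  +-cancelʳ-≡ k (i + j) a (+-cancelˡ-≡ (c + c + k) (i + j + k) (a + k) (trans (sym (shifted-sum c k i j)) eq))

shift-< : ∀ a b k → True (a <? b) → a + k < b + k
shift-< a b k a<b = +-monoˡ-< k (toWitness a<b)

≤-maxPart : ∀ a k → True (a ≤? 17) → a + k ≤ maxPart k
≤-maxPart a k a≤17 = ≤-trans (+-monoˡ-≤ k (toWitness a≤17)) (≤-trans (m≤m+n (17 + k) k) (≤-reflexive (regroup k)))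
  where
  regroup : ∀ k → 17 + k + k ≡ suc ((8 + k) + (8 + k))
  regroup = solve-∀

tail₁ : ℕ → List ℕ
tail₁ k = 8 + k ∷ 10 + k ∷ 11 + k ∷ maxPart k ∷ []

w₁ : ℕ → List ℕ
w₁ k = oneTo (5 + k) ++ tail₁ k

tail₂ : ℕ → List ℕ
tail₂ k = 6 + k ∷ 7 + k ∷ 9 + k ∷ 12 + k ∷ maxPart k ∷ []

w₂ : ℕ → List ℕ
w₂ k = oneTo (4 + k) ++ tail₂ k

w₁-partition : ∀ k → DistinctPartition (total k) (w₁ k)
w₁-partition k = subst (λ N → DistinctPartition N (w₁ k)) (regroup (tri (5 + k)) k)
  (prefixed-partition (5 + k)
    (shift-< 8 10 k _ ∷ shift-< 10 11 k _ ∷ ≤-maxPart 12 k _ ∷ [-])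
    (shift-< 5 8 k _ ∷ shift-< 5 10 k _ ∷ shift-< 5 11 k _ ∷ ≤-maxPart 6 k _ ∷ [])
    (s≤s (s≤s z≤n)))
  where
  regroup : ∀ T k → T + (8 + k + (10 + k + (11 + k + (suc ((8 + k) + (8 + k)) + 0))))
                  ≡ T + (6 + k) + (7 + k) + (8 + k) + (25 + (k + k))
  regroup = solve-∀

w₂-partition : ∀ k → DistinctPartition (total k) (w₂ k)
w₂-partition k = subst (λ N → DistinctPartition N (w₂ k)) (regroup (tri (4 + k)) k)
  (prefixed-partition (4 + k)
    (shift-< 6 7 k _ ∷ shift-< 7 9 k _ ∷ shift-< 9 12 k _ ∷ ≤-maxPart 13 k _ ∷ [-])
    (shift-< 4 6 k _ ∷ shift-< 4 7 k _ ∷ shift-< 4 9 k _ ∷ shift-< 4 12 k _ ∷ ≤-maxPart 5 k _ ∷ [])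
    (s≤s (s≤s z≤n)))
  where
  regroup : ∀ T k → T + (6 + k + (7 + k + (9 + k + (12 + k + (suc ((8 + k) + (8 + k)) + 0)))))
                  ≡ T + (5 + k) + (6 + k) + (7 + k) + (8 + k) + (25 + (k + k))
  regroup = solve-∀

largest-w₁ : ∀ k → largest (w₁ k) ≡ maxPart k
largest-w₁ k = largest-prefixed (≤-maxPart 8 k _ ∷ ≤-maxPart 10 k _ ∷ ≤-maxPart 11 k _ ∷ ≤-refl ∷ [])
                                (there (there (there (here refl)))) (≤-maxPart 5 k _)

largest-w₂ : ∀ k → largest (w₂ k) ≡ maxPart k
largest-w₂ k = largest-prefixed (≤-maxPart 6 k _ ∷ ≤-maxPart 7 k _ ∷ ≤-maxPart 9 k _ ∷ ≤-maxPart 12 k _ ∷ ≤-refl ∷ [])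
                                (there (there (there (there (here refl))))) (≤-maxPart 4 k _)

w₁-unrefinable : ∀ k → Unrefinable (w₁ k)
w₁-unrefinable k = prefixed-unrefinable (5 + k) no-sum
  where
  halves : ∀ i j → i + j ≡ 5 → i + (6 + k) ∈ tail₁ k ⊎ j + (6 + k) ∈ tail₁ k
  halves 0 _ refl = inj₂ (there (there (here refl)))
  halves 1 _ refl = inj₂ (there (here refl))
  halves 2 _ refl = inj₁ (here refl)
  halves 3 _ refl = inj₂ (here refl)
  halves 4 _ refl = inj₁ (there (here refl))
  halves 5 _ refl = inj₁ (there (there (here refl)))
  halves (suc (suc (suc (suc (suc (suc i)))))) _ ()
  no-sum : ∀ {x y} → 5 + k < x → 5 + k < y → x ≢ y → x ∉ tail₁ k → y ∉ tail₁ k → x + y ∉ tail₁ k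
  no-sum 5+k<x 5+k<y _ x∉ y∉ x+y∈ with m<n⇒∃[o]o+1+m≡n 5+k<x | m<n⇒∃[o]o+1+m≡n 5+k<y
  ... | i , refl | j , refl with x+y∈
  ... | here eq                         = shifted-sum-≢ 6 k 8 i j _ eq
  ... | there (here eq)                 = shifted-sum-≢ 6 k 10 i j _ eq
  ... | there (there (here eq))         = shifted-sum-≢ 6 k 11 i j _ eq
  ... | there (there (there (here eq))) =
    [ x∉ , y∉ ]′ (halves i j (shifted-sum-≡ 6 k 5 i j (trans eq (regroup k))))
    where
    regroup : ∀ k → suc ((8 + k) + (8 + k)) ≡ 12 + k + (5 + k)
    regroup = solve-∀

w₂-unrefinable : ∀ k → Unrefinable (w₂ k)
w₂-unrefinable k = prefixed-unrefinable (4 + k) no-sum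
  where
  halves : ∀ i j → i + j ≡ 7 → i + (5 + k) ∈ tail₂ k ⊎ j + (5 + k) ∈ tail₂ k
  halves 0 _ refl = inj₂ (there (there (there (here refl))))
  halves 1 _ refl = inj₁ (here refl)
  halves 2 _ refl = inj₁ (there (here refl))
  halves 3 _ refl = inj₂ (there (there (here refl)))
  halves 4 _ refl = inj₁ (there (there (here refl)))
  halves 5 _ refl = inj₂ (there (here refl))
  halves 6 _ refl = inj₂ (here refl)
  halves 7 _ refl = inj₁ (there (there (there (here refl))))
  halves (suc (suc (suc (suc (suc (suc (suc (suc i)))))))) _ ()
  -- 12 + k is a sum of two distinct values above 4 + k only if k ≤ 2.
  near-halves : ∀ i j → i + j + k ≡ 2 → i + (5 + k) ≢ j + (5 + k) → i + (5 + k) ∈ tail₂ k ⊎ j + (5 + k) ∈ tail₂ k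
  near-halves 0 0 _ i≢j = ⊥-elim (i≢j refl)
  near-halves 0 1 _ _   = inj₂ (here refl)
  near-halves 0 2 _ _   = inj₂ (there (here refl))
  near-halves 1 _ _ _   = inj₁ (here refl)
  near-halves 2 _ _ _   = inj₁ (there (here refl))
  near-halves 0 (suc (suc (suc j))) () _
  near-halves (suc (suc (suc i))) _ () _
  no-sum : ∀ {x y} → 4 + k < x → 4 + k < y → x ≢ y → x ∉ tail₂ k → y ∉ tail₂ k → x + y ∉ tail₂ k
  no-sum 4+k<x 4+k<y x≢y x∉ y∉ x+y∈ with m<n⇒∃[o]o+1+m≡n 4+k<x | m<n⇒∃[o]o+1+m≡n 4+k<y
  ... | i , refl | j , refl with x+y∈
  ... | here eq                                = shifted-sum-≢ 5 k 6 i j _ eq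
  ... | there (here eq)                        = shifted-sum-≢ 5 k 7 i j _ eq
  ... | there (there (here eq))                = shifted-sum-≢ 5 k 9 i j _ eq
  ... | there (there (there (here eq)))        =
    [ x∉ , y∉ ]′ (near-halves i j (+-cancelˡ-≡ (10 + k) (i + j + k) 2 (trans (sym (shifted-sum 5 k i j)) (trans eq (+-comm 2 (10 + k))))) x≢y)
  ... | there (there (there (there (here eq)))) =
    [ x∉ , y∉ ]′ (halves i j (shifted-sum-≡ 5 k 7 i j (trans eq (regroup k))))
    where
    regroup : ∀ k → suc ((8 + k) + (8 + k)) ≡ 10 + k + (7 + k)
    regroup = solve-∀

tri*2 : ∀ n → tri n * 2 ≡ n * suc n
tri*2 zero    = refl
tri*2 (suc n) = begin
  (tri n + suc n) * 2          ≡⟨ *-distribʳ-+ 2 (tri n) (suc n) ⟩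
  tri n * 2 + suc n * 2        ≡⟨ cong (_+ suc n * 2) (tri*2 n) ⟩
  n * suc n + suc n * 2        ≡⟨ regroup n ⟩
  suc n * suc (suc n)          ∎
  where
  open ≡-Reasoning
  regroup : ∀ n → n * suc n + suc n * 2 ≡ suc n * suc (suc n)
  regroup = solve-∀

T≡total : ∀ k → T (11 + k) (11 + k ∸ 6) ≡ total k
T≡total k = begin
  (11 + k) * suc (11 + k) / 2 ∸ (5 + k)    ≡⟨ cong (λ x → x / 2 ∸ (5 + k)) (sym (tri*2 (11 + k))) ⟩
  tri (11 + k) * 2 / 2 ∸ (5 + k)           ≡⟨ cong (_∸ (5 + k)) (m*n/n≡m (tri (11 + k)) 2) ⟩
  tri (11 + k) ∸ (5 + k)                   ≡⟨ cong (_∸ (5 + k)) (regroup (tri (8 + k)) k) ⟩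
  total k + (5 + k) ∸ (5 + k)              ≡⟨ m+n∸n≡m (total k) (5 + k) ⟩
  total k                                  ∎
  where
  open ≡-Reasoning
  regroup : ∀ T k → T + (9 + k) + (10 + k) + (11 + k) ≡ T + (25 + (k + k)) + (5 + k)
  regroup = solve-∀

U*-total : ∀ k → HasExactlyTwo (InUStar (total k))
U*-total k = w₁ k , w₂ k , w₁≢w₂ , maximal u₁ (largest-w₁ k) , maximal u₂ (largest-w₂ k) , only
  where
  u₁ : InU (total k) (w₁ k)
  u₁ = w₁-partition k , w₁-unrefinable k
  u₂ : InU (total k) (w₂ k)
  u₂ = w₂-partition k , w₂-unrefinable k
  maximal : ∀ {λs} → InU (total k) λs → largest λs ≡ maxPart k → InUStar (total k) λs
  maximal u top = u , λ μs v → subst (largest μs ≤_) (sym top) (largest≤maxPart v)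
  5+k∈w₁ : 5 + k ∈ w₁ k
  5+k∈w₁ = ∈-++⁺ˡ (∈-oneTo⁺ (s≤s z≤n) ≤-refl)
  5+k∉w₂ : 5 + k ∉ w₂ k
  5+k∉w₂ 5+k∈ with ∈-++⁻ (oneTo (4 + k)) 5+k∈
  ... | inj₁ 5+k∈oneTo = 1+n≰n (proj₂ (∈-oneTo⁻ 5+k∈oneTo))
  ... | inj₂ 5+k∈tail  = <-irrefl refl (All.lookup 5+k<tail 5+k∈tail)
    where
    5+k<tail : All (5 + k <_) (tail₂ k)
    5+k<tail = shift-< 5 6 k _ ∷ shift-< 5 7 k _ ∷ shift-< 5 9 k _ ∷ shift-< 5 12 k _ ∷ ≤-maxPart 6 k _ ∷ []
  w₁≢w₂ : w₁ k ≢ w₂ k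
  w₁≢w₂ w₁≡w₂ = 5+k∉w₂ (subst (5 + k ∈_) w₁≡w₂ 5+k∈w₁)
  classify : ∀ {λs} → InU (total k) λs → largest λs ≡ maxPart k → λs ≡ w₁ k ⊎ λs ≡ w₂ k
  classify u@(P , _) top with DistinctParts.occ-binary P (5 + k)
  ... | inj₂ present = inj₁ (unique-at-maximum u u₁ top (largest-w₁ k)
                              (trans present (sym (DistinctParts.occ-part (proj₁ u₁) 5+k∈w₁))))
  ... | inj₁ absent  = inj₂ (unique-at-maximum u u₂ top (largest-w₂ k)
                              (trans absent (sym (∉⇒occ≡0 (w₂ k) 5+k∉w₂))))
  only : ∀ λs → InUStar (total k) λs → λs ≡ w₁ k ⊎ λs ≡ w₂ k
  only λs (u , maximum) =
    classify u (≤-antisym (largest≤maxPart u) (subst (_≤ largest λs) (largest-w₁ k) (maximum (w₁ k) u₁)))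

corollary3p14 : ∀ (n : ℕ) → 11 ≤ n → HasExactlyTwo (InUStar (T n (n ∸ 6)))
corollary3p14 n 11≤n with m≤n⇒∃[o]m+o≡n 11≤n
... | k , refl = subst (HasExactlyTwo ∘ InUStar) (sym (T≡total k)) (U*-total k)
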